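{- For all integers $1\le k<n$, $$k\prod_{i=1}^{n-k-1}(n+i)=(n-k-1)!\sum_{i=0}^{k-1}(k-i)\binom{k}{i}\binom{2n-2k}{n-i}.$$
   Context: An empty product equals $1$. -}

module Defs where

open import Data.Nat using (ℕ; zero; suc; _+_; _*_)

prodFrom1 : ℕ → (ℕ → ℕ) → ℕ
prodFrom1 zero    f = 1
prodFrom1 (suc n) f = prodFrom1 n f * f (suc n)

sumBelow : ℕ → (ℕ → ℕ) → ℕ
sumBelow zero    f = 0
sumBelow (suc n) f = sumBelow n f + f n

-- Absorption turns the weight (k − i)·C(k, i) into k·C(k − 1, i), so the sum is k times a
-- Vandermonde convolution, equal to k·C(2(n − k) + k − 1, n) = k·C(n + p, n) with p = n − k − 1.
-- On the other side the rising product (n + 1)⋯(n + p) is p!·C(n + p, p), and the two binomial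
-- coefficients agree by symmetry.
module Submission where

open import Defs
open import Data.Nat using (ℕ; zero; suc; s≤s; _+_; _*_; _∸_; _≤_; _<_; _!)
open import Data.Nat.Combinatorics
  using (_C_; nCk+nC[k+1]≡[n+1]C[k+1]; nCk≡nC[n∸k]; k>n⇒nCk≡0; nC1≡n)
open import Data.Nat.Properties
open import Data.Nat.Tactic.RingSolver using (solve-∀)
open import Data.Product using (_,_)
open import Data.Sum using (inj₁; inj₂)
open import Relation.Binary.PropositionalEquality
  using (_≡_; refl; sym; trans; cong; cong₂; module ≡-Reasoning)

open ≡-Reasoning

import Algebra.Properties.CommutativeSemigroup as CommSemigroupProperties
module +-CS = CommSemigroupProperties +-commutativeSemigroup
module *-CS = CommSemigroupProperties *-commutativeSemigroup

sumBelow-cong : ∀ n {f g : ℕ → ℕ} → (∀ i → f i ≡ g i) → sumBelow n f ≡ sumBelow n g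
sumBelow-cong zero    f≡g = refl
sumBelow-cong (suc n) f≡g = cong₂ _+_ (sumBelow-cong n f≡g) (f≡g n)

sumBelow-suc : ∀ n (f : ℕ → ℕ) → sumBelow (suc n) f ≡ f 0 + sumBelow n (λ i → f (suc i))
sumBelow-suc zero    f = +-comm 0 (f 0)
sumBelow-suc (suc n) f = trans (cong (_+ f (suc n)) (sumBelow-suc n f)) (+-assoc (f 0) _ _)

sumBelow-distrib-+ : ∀ n (f g : ℕ → ℕ) →
  sumBelow n (λ i → f i + g i) ≡ sumBelow n f + sumBelow n g
sumBelow-distrib-+ zero    f g = refl
sumBelow-distrib-+ (suc n) f g =
  trans (cong (_+ (f n + g n)) (sumBelow-distrib-+ n f g))
        (+-CS.interchange (sumBelow n f) (sumBelow n g) (f n) (g n))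

*-distribˡ-sumBelow : ∀ n c (f : ℕ → ℕ) → c * sumBelow n f ≡ sumBelow n (λ i → c * f i)
*-distribˡ-sumBelow zero    c f = *-zeroʳ c
*-distribˡ-sumBelow (suc n) c f =
  trans (*-distribˡ-+ c (sumBelow n f) (f n)) (cong (_+ c * f n) (*-distribˡ-sumBelow n c f))

pascal : ∀ n k → suc n C suc k ≡ n C k + n C suc k
pascal n k = sym (nCk+nC[k+1]≡[n+1]C[k+1] n k)

C-absorb : ∀ n k → suc k * (suc n C suc k) ≡ suc n * (n C k)
C-absorb n       zero    = trans (*-identityˡ _) (trans (nC1≡n (suc n)) (sym (*-identityʳ _)))
C-absorb zero    (suc k) = *-zeroʳ (suc (suc k))
C-absorb (suc n) (suc k) = begin
    suc (suc k) * (suc (suc n) C suc (suc k))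
  ≡⟨ cong (suc (suc k) *_) (pascal (suc n) (suc k)) ⟩
    suc (suc k) * (C₁ + C₂)
  ≡⟨ *-distribˡ-+ (suc (suc k)) C₁ C₂ ⟩
    (C₁ + suc k * C₁) + suc (suc k) * C₂
  ≡⟨ cong₂ (λ x y → (C₁ + x) + y) (C-absorb n k) (C-absorb n (suc k)) ⟩
    (C₁ + suc n * (n C k)) + suc n * (n C suc k)
  ≡⟨ +-assoc C₁ _ _ ⟩
    C₁ + (suc n * (n C k) + suc n * (n C suc k))
  ≡⟨ cong (C₁ +_) (sym (*-distribˡ-+ (suc n) (n C k) (n C suc k))) ⟩
    C₁ + suc n * (n C k + n C suc k)
  ≡⟨ cong (λ x → C₁ + suc n * x) (sym (pascal n k)) ⟩
    suc (suc n) * C₁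
  ∎
  where
  C₁ = suc n C suc k
  C₂ = suc n C suc (suc k)

C-absorb-complement : ∀ n i → (suc n ∸ i) * (suc n C i) ≡ suc n * (n C i)
C-absorb-complement n i with ≤-<-connex i n
... | inj₁ i≤n = begin
    (suc n ∸ i) * (suc n C i)
  ≡⟨ cong₂ _*_ 1+n∸i≡1+[n∸i] (trans (nCk≡nC[n∸k] (m≤n⇒m≤1+n i≤n)) (cong (suc n C_) 1+n∸i≡1+[n∸i])) ⟩
    suc (n ∸ i) * (suc n C suc (n ∸ i))
  ≡⟨ C-absorb n (n ∸ i) ⟩
    suc n * (n C (n ∸ i))
  ≡⟨ cong (suc n *_) (sym (nCk≡nC[n∸k] i≤n)) ⟩
    suc n * (n C i)
  ∎
  where
  1+n∸i≡1+[n∸i] : suc n ∸ i ≡ suc (n ∸ i)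
  1+n∸i≡1+[n∸i] = +-∸-assoc 1 i≤n
... | inj₂ n<i = begin
    (suc n ∸ i) * (suc n C i)
  ≡⟨ cong (_* (suc n C i)) (m≤n⇒m∸n≡0 n<i) ⟩
    0
  ≡⟨ sym (trans (cong (suc n *_) (k>n⇒nCk≡0 n<i)) (*-zeroʳ (suc n))) ⟩
    suc n * (n C i)
  ∎

prodFrom1[c+i]≡p!*[c+p]Cp : ∀ c p → prodFrom1 p (c +_) ≡ p ! * ((c + p) C p)
prodFrom1[c+i]≡p!*[c+p]Cp c zero    = refl
prodFrom1[c+i]≡p!*[c+p]Cp c (suc p) = begin
    prodFrom1 p (c +_) * (c + suc p)
  ≡⟨ cong₂ _*_ (prodFrom1[c+i]≡p!*[c+p]Cp c p) (+-suc c p) ⟩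
    p ! * ((c + p) C p) * suc (c + p)
  ≡⟨ *-CS.xy∙z≈x∙zy (p !) _ _ ⟩
    p ! * (suc (c + p) * ((c + p) C p))
  ≡⟨ cong (p ! *_) (sym (C-absorb (c + p) p)) ⟩
    p ! * (suc p * (suc (c + p) C suc p))
  ≡⟨ sym (*-assoc (p !) (suc p) _) ⟩
    p ! * suc p * (suc (c + p) C suc p)
  ≡⟨ cong (_* (suc (c + p) C suc p)) (*-comm (p !) (suc p)) ⟩
    suc p ! * (suc (c + p) C suc p)
  ≡⟨ cong (λ m → suc p ! * (m C suc p)) (sym (+-suc c p)) ⟩
    suc p ! * ((c + suc p) C suc p)
  ∎

-- The upper index is written a + r so that a + r ∸ i never truncates for i ≤ a.
vandermonde : ∀ a N r →
  sumBelow (suc a) (λ i → (a C i) * (N C (a + r ∸ i))) ≡ (a + N) C (a + r)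
vandermonde zero    N r = +-identityʳ (N C r)
vandermonde (suc a) N r = begin
    sumBelow (suc (suc a)) (λ i → (suc a C i) * g i)
  ≡⟨ sumBelow-suc (suc a) _ ⟩
    g 0 + 0 + sumBelow (suc a) (λ i → (suc a C suc i) * g (suc i))
  ≡⟨ cong (g 0 + 0 +_) (sumBelow-cong (suc a) λ i → cong (_* g (suc i)) (pascal a i)) ⟩
    g 0 + 0 + sumBelow (suc a) (λ i → (a C i + a C suc i) * g (suc i))
  ≡⟨ cong (g 0 + 0 +_) (sumBelow-cong (suc a) λ i → *-distribʳ-+ (g (suc i)) (a C i) _) ⟩
    g 0 + 0 + sumBelow (suc a) (λ i → (a C i) * g (suc i) + (a C suc i) * g (suc i))
  ≡⟨ cong (g 0 + 0 +_) (sumBelow-distrib-+ (suc a) _ _) ⟩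
    g 0 + 0 + (S₁ + S₂)
  ≡⟨ +-CS.x∙yz≈y∙xz (g 0 + 0) S₁ S₂ ⟩
    S₁ + (g 0 + 0 + S₂)
  ≡⟨ cong₂ _+_ (vandermonde a N r) shifted ⟩
    (a + N) C (a + r) + (a + N) C suc (a + r)
  ≡⟨ sym (pascal (a + N) (a + r)) ⟩
    (suc a + N) C (suc a + r)
  ∎
  where
  g : ℕ → ℕ
  g i = N C (suc a + r ∸ i)
  S₁ = sumBelow (suc a) (λ i → (a C i) * g (suc i))
  S₂ = sumBelow (suc a) (λ i → (a C suc i) * g (suc i))
  shifted : g 0 + 0 + S₂ ≡ (a + N) C suc (a + r)
  shifted = begin
      g 0 + 0 + S₂
    ≡⟨ sym (sumBelow-suc (suc a) (λ i → (a C i) * g i)) ⟩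
      sumBelow (suc a) (λ i → (a C i) * g i) + (a C suc a) * g (suc a)
    ≡⟨ cong (λ c → sumBelow (suc a) (λ i → (a C i) * g i) + c * g (suc a)) (k>n⇒nCk≡0 (n<1+n a)) ⟩
      sumBelow (suc a) (λ i → (a C i) * g i) + 0
    ≡⟨ +-identityʳ _ ⟩
      sumBelow (suc a) (λ i → (a C i) * g i)
    ≡⟨ sumBelow-cong (suc a) (λ i → cong (λ s → (a C i) * (N C (s ∸ i))) (sym (+-suc a r))) ⟩
      sumBelow (suc a) (λ i → (a C i) * (N C (a + suc r ∸ i)))
    ≡⟨ vandermonde a N (suc r) ⟩
      (a + N) C (a + suc r)
    ≡⟨ cong ((a + N) C_) (+-suc a r) ⟩
      (a + N) C suc (a + r)
    ∎

weighted-vandermonde : ∀ a N s → a ≤ s →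
  sumBelow (suc a) (λ i → (suc a ∸ i) * ((suc a C i) * (N C (s ∸ i)))) ≡ suc a * ((a + N) C s)
weighted-vandermonde a N s a≤s with m≤n⇒∃[o]m+o≡n a≤s
... | r , refl = begin
    sumBelow (suc a) (λ i → (suc a ∸ i) * ((suc a C i) * (N C (a + r ∸ i))))
  ≡⟨ sumBelow-cong (suc a) absorb ⟩
    sumBelow (suc a) (λ i → suc a * ((a C i) * (N C (a + r ∸ i))))
  ≡⟨ sym (*-distribˡ-sumBelow (suc a) (suc a) _) ⟩
    suc a * sumBelow (suc a) (λ i → (a C i) * (N C (a + r ∸ i)))
  ≡⟨ cong (suc a *_) (vandermonde a N r) ⟩
    suc a * ((a + N) C (a + r))
  ∎
  where
  absorb : ∀ i → (suc a ∸ i) * ((suc a C i) * (N C (a + r ∸ i)))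
               ≡ suc a * ((a C i) * (N C (a + r ∸ i)))
  absorb i = begin
      (suc a ∸ i) * ((suc a C i) * (N C (a + r ∸ i)))
    ≡⟨ sym (*-assoc (suc a ∸ i) _ _) ⟩
      (suc a ∸ i) * (suc a C i) * (N C (a + r ∸ i))
    ≡⟨ cong (_* (N C (a + r ∸ i))) (C-absorb-complement a i) ⟩
      suc a * (a C i) * (N C (a + r ∸ i))
    ≡⟨ *-assoc (suc a) (a C i) (N C (a + r ∸ i)) ⟩
      suc a * ((a C i) * (N C (a + r ∸ i)))
    ∎

n+[n∸k∸1]≡[k∸1]+[2n∸2k] : ∀ a {n} → suc a < n → n + (n ∸ suc a ∸ 1) ≡ a + (2 * n ∸ 2 * suc a)
n+[n∸k∸1]≡[k∸1]+[2n∸2k] a {n} k<n = begin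
    n + p
  ≡⟨ cong (_+ p) (sym (m+[n∸m]≡n (<⇒≤ k<n))) ⟩
    suc a + (n ∸ suc a) + p
  ≡⟨ cong (λ d → suc a + d + p) n∸k≡1+p ⟩
    suc a + suc p + p
  ≡⟨ regroup a p ⟩
    a + 2 * suc p
  ≡⟨ cong (λ d → a + 2 * d) (sym n∸k≡1+p) ⟩
    a + 2 * (n ∸ suc a)
  ≡⟨ cong (a +_) (*-distribˡ-∸ 2 n (suc a)) ⟩
    a + (2 * n ∸ 2 * suc a)
  ∎
  where
  p = n ∸ suc a ∸ 1
  n∸k≡1+p : n ∸ suc a ≡ suc p
  n∸k≡1+p = sym (trans (+-comm 1 p) (m∸n+n≡m (m<n⇒0<n∸m k<n)))
  regroup : ∀ x y → suc x + suc y + y ≡ x + 2 * suc y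
  regroup = solve-∀

mainTheorem19 : (k n : ℕ) → 1 ≤ k → k < n →
    k * prodFrom1 (n ∸ k ∸ 1) (λ i → n + i)
      ≡ ((n ∸ k ∸ 1) !) * sumBelow k (λ i → (k ∸ i) * ((k C i) * ((2 * n ∸ 2 * k) C (n ∸ i))))
mainTheorem19 k@(suc a) n (s≤s _) k<n = begin
    k * prodFrom1 p (n +_)
  ≡⟨ cong (k *_) (prodFrom1[c+i]≡p!*[c+p]Cp n p) ⟩
    k * (p ! * ((n + p) C p))
  ≡⟨ *-CS.x∙yz≈y∙xz k (p !) _ ⟩
    p ! * (k * ((n + p) C p))
  ≡⟨ cong (λ c → p ! * (k * c)) (nCk≡nC[n∸k] (m≤n+m p n)) ⟩
    p ! * (k * ((n + p) C (n + p ∸ p)))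
  ≡⟨ cong₂ (λ m j → p ! * (k * (m C j))) (n+[n∸k∸1]≡[k∸1]+[2n∸2k] a k<n) (m+n∸n≡m n p) ⟩
    p ! * (k * ((a + N) C n))
  ≡⟨ cong (p ! *_) (sym (weighted-vandermonde a N n (<⇒≤ (<-trans (n<1+n a) k<n)))) ⟩
    p ! * sumBelow k (λ i → (k ∸ i) * ((k C i) * (N C (n ∸ i))))
  ∎
  where
  p = n ∸ k ∸ 1
  N = 2 * n ∸ 2 * k
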